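{- Let $G$ be a $(\delta-2)$-fault Hamiltonian graph with minimum degree $\delta\geq 3$ and let $F$ be a set of vertices and/or edges of $G$ with $|F|=\delta-1$; write $F_V=F\cap V(G)$, $F_E=F\cap E(G)$. If $G-F$ has no fractional perfect matching, then $|G|-|F_V|$ is odd. Furthermore, if $|G|$ is even then $|F_E|\leq \delta-2$.
   Context: All graphs are finite, simple, undirected; $|G|$ is the number of vertices. For a set $X$ of vertices and/or edges, $G-X$ is obtained by deleting the vertices of $X$ (with incident edges) and the edges of $X$. $G$ is $f$-fault Hamiltonian if $G-X$ has a Hamiltonian cycle for every set $X$ of vertices and/or edges with $|X|\leq f$. A fractional perfect matching is $g:E\to[0,1]$ with $\sum_{e\ni v}g(e)=1$ for every vertex $v$. -}

module Defs where

open import Data.Nat as ℕ using (ℕ; zero; suc; _+_; _*_; _∸_; _<_)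
open import Data.Bool using (Bool; true; false; if_then_else_)
open import Data.Fin using (Fin; toℕ)
import Data.Fin as Fin
open import Data.List using (List; []; _∷_; _++_; [_]; length)
open import Data.List.Membership.Propositional using (_∈_)
open import Data.List.Relation.Unary.All using (All)
open import Data.List.Relation.Unary.Unique.Propositional using (Unique)
open import Data.Product using (Σ; ∃; _×_; _,_; proj₁; proj₂)
open import Data.Unit using (⊤)
open import Data.Empty using (⊥)
open import Relation.Nullary using (¬_)
open import Relation.Binary.PropositionalEquality using (_≡_)
open import Data.Rational as ℚ using (ℚ; 0ℚ; 1ℚ)

record Graph (n : ℕ) : Set where
  field
    adj     : Fin n → Fin n → Bool
    sym     : ∀ i j → adj i j ≡ adj j i
    irrefl  : ∀ i → adj i i ≡ false
open Graph public

∣_∣ᵥ : ∀ {n} → Graph n → ℕ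
∣_∣ᵥ {n} _ = n

count : ∀ {n} → (Fin n → Bool) → ℕ
count {zero}  f = 0
count {suc n} f = (if f Fin.zero then 1 else 0) + count (λ k → f (Fin.suc k))

degree : ∀ {n} → Graph n → Fin n → ℕ
degree G v = count (adj G v)

MinDegree : ∀ {n} → Graph n → ℕ → Set
MinDegree G δ = (∀ v → δ ℕ.≤ degree G v) × ∃ (λ v → degree G v ≡ δ)

-- A set X of vertices and/or edges of G.  Edges are stored as ordered pairs
-- (i , j) with i < j (so each edge has a unique representation).
record FaultSet {n : ℕ} (G : Graph n) : Set where
  field
    vs      : List (Fin n)
    es      : List (Fin n × Fin n)
    vs-uniq : Unique vs
    es-uniq : Unique es
    es-edge : All (λ e → (adj G (proj₁ e) (proj₂ e) ≡ true) × (toℕ (proj₁ e) < toℕ (proj₂ e))) es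
open FaultSet public

size : ∀ {n} {G : Graph n} → FaultSet G → ℕ
size X = length (vs X) + length (es X)

VertexOf : ∀ {n} {G : Graph n} → FaultSet G → Fin n → Set
VertexOf X v = ¬ (v ∈ vs X)

EdgeOf : ∀ {n} {G : Graph n} → FaultSet G → Fin n → Fin n → Set
EdgeOf {G = G} X i j =
  (adj G i j ≡ true) × VertexOf X i × VertexOf X j
  × ¬ ((i , j) ∈ es X) × ¬ ((j , i) ∈ es X)

Consec : ∀ {A : Set} → (A → A → Set) → List A → Set
Consec R []           = ⊤
Consec R (x ∷ [])     = ⊤
Consec R (x ∷ y ∷ xs) = R x y × Consec R (y ∷ xs)

HamCycle : ∀ {n} {G : Graph n} → FaultSet G → List (Fin n) → Set
HamCycle X []       = ⊥
HamCycle X (x ∷ xs) =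
  Unique (x ∷ xs) × (3 ℕ.≤ length (x ∷ xs))
  × (∀ v → (v ∈ (x ∷ xs) → VertexOf X v) × (VertexOf X v → v ∈ (x ∷ xs)))
  × Consec (EdgeOf X) (x ∷ xs ++ [ x ])

Hamiltonian-minus : ∀ {n} {G : Graph n} → FaultSet G → Set
Hamiltonian-minus X = ∃ (λ c → HamCycle X c)

FaultHamiltonian : ∀ {n} → ℕ → Graph n → Set
FaultHamiltonian f G = ∀ (X : FaultSet G) → size X ℕ.≤ f → Hamiltonian-minus X

sumℚ : ∀ {n} → (Fin n → ℚ) → ℚ
sumℚ {zero}  f = 0ℚ
sumℚ {suc n} f = f Fin.zero ℚ.+ sumℚ (λ k → f (Fin.suc k))

FractionalPerfectMatching : ∀ {n} {G : Graph n} → FaultSet G → Set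
FractionalPerfectMatching {n} X =
  Σ (Fin n → Fin n → ℚ) λ g →
    (∀ i j → g i j ≡ g j i)
    × (∀ i j → (0ℚ ℚ.≤ g i j) × (g i j ℚ.≤ 1ℚ))
    × (∀ i j → ¬ EdgeOf X i j → g i j ≡ 0ℚ)
    × (∀ v → VertexOf X v → sumℚ (g v) ≡ 1ℚ)

Odd : ℕ → Set
Odd m = ∃ λ k → m ≡ suc (2 * k)

Even : ℕ → Set
Even m = ∃ λ k → m ≡ 2 * k

{-# OPTIONS --safe #-}
-- Delete one element x of F: the remaining δ − 2 faults leave a Hamiltonian cycle C of
-- G − (F − x).  If x is a vertex, C − x is a Hamiltonian path of G − F.  If x is an edge ij,
-- start C at i and open it at the edge back into i, or at ij itself when the successor of i
-- is j.  Either way G − F has a Hamiltonian path on |G| − |F_V| vertices, and were that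
-- number even, every other edge of the path would be a perfect matching of G − F.  When |G|
-- is even, F_V is therefore nonempty, so |F_E| ≤ |F| − 1 = δ − 2.
module Submission where

open import Defs hiding (sym)
open import Data.Nat using (ℕ; zero; suc; _+_; _≤_; _<_; _∸_; s≤s)
open import Data.Nat.Properties using (*-suc; m+n∸n≡m; ≤-reflexive; suc-injective; m≤n+m; even≢odd)
open import Data.Bool using (Bool; true; false; if_then_else_)
open import Data.Empty using (⊥; ⊥-elim)
open import Data.Fin using (Fin; zero; suc; toℕ)
open import Data.Fin.Properties using (_≟_)
open import Data.List using (List; []; _∷_; _++_; [_]; length; allFin)
open import Data.List.Properties using (++-assoc; length-++; length-tabulate)
open import Data.List.Membership.Propositional using (_∈_; _∉_)
open import Data.List.Membership.Propositional.Properties using (∈-∃++; ∈-++⁺ˡ; ∈-++⁺ʳ; ∈-allFin)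
open import Data.List.Membership.Propositional.Properties.WithK using (unique∧set⇒bag)
open import Data.List.Relation.Binary.BagAndSetEquality using (∼bag⇒↭; _∼[_]_; set)
open import Data.List.Relation.Binary.Permutation.Propositional using (_↭_; ↭-sym; ↭⇒↭ₛ)
open import Data.List.Relation.Binary.Permutation.Propositional.Properties using (↭-length; ∈-resp-↭; ++-comm)
import Data.List.Relation.Binary.Permutation.Setoid.Properties as Setoid↭
open import Data.List.Relation.Unary.All using (All; _∷_)
open import Data.List.Relation.Unary.All.Properties using (All¬⇒¬Any)
open import Data.List.Relation.Unary.AllPairs using ([]; _∷_)
open import Data.List.Relation.Unary.Any using (here; there; any?)
open import Data.List.Relation.Unary.Unique.Propositional using (Unique)
open import Data.List.Relation.Unary.Unique.Propositional.Properties using (++⁺; allFin⁺; Unique[x∷xs]⇒x∉xs)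
open import Data.Product using (∃; _×_; _,_; proj₁; proj₂)
open import Data.Rational using (ℚ; 0ℚ; 1ℚ)
import Data.Rational as ℚ
open import Data.Rational.Properties using (≤-refl; nonNegative⁻¹)
open import Data.Sum using (_⊎_; inj₁; inj₂)
open import Data.Unit using (tt)
open import Function.Bundles using (_⇔_; mk⇔; Equivalence)
open import Relation.Binary.Definitions using (Symmetric)
open import Relation.Binary.PropositionalEquality
  using (_≡_; _≢_; refl; sym; trans; cong; cong₂; subst; module ≡-Reasoning)
open import Relation.Binary.PropositionalEquality.Properties using (setoid)
open import Relation.Nullary using (¬_; Dec; does; yes; no; _×-dec_; _⊎-dec_)
open import Relation.Nullary.Decidable using (does-⇔)

Odd⇒¬Even : ∀ {m} → Odd m → ¬ Even m
Odd⇒¬Even (k , m≡1+2k) (l , m≡2l) = even≢odd l k (trans (sym m≡2l) m≡1+2k)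

Unique-resp-↭ : ∀ {A : Set} {xs ys : List A} → xs ↭ ys → Unique xs → Unique ys
Unique-resp-↭ {A} xs↭ys = Setoid↭.Unique-resp-↭ (setoid A) (↭⇒↭ₛ xs↭ys)

length-complement : ∀ {n} {xs ys : List (Fin n)} → Unique xs → Unique ys
  → (∀ {v} → v ∈ xs → v ∉ ys) → (∀ {v} → v ∉ ys → v ∈ xs)
  → length xs + length ys ≡ n
length-complement {n} {xs} {ys} xs! ys! disjoint cover = begin
    length xs + length ys ≡⟨ sym (length-++ xs) ⟩
    length (xs ++ ys)     ≡⟨ ↭-length (∼bag⇒↭ (unique∧set⇒bag xs++ys! (allFin⁺ n) everything)) ⟩
    length (allFin n)     ≡⟨ length-tabulate _ ⟩
    n                     ∎
  where
    open ≡-Reasoning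
    xs++ys! : Unique (xs ++ ys)
    xs++ys! = ++⁺ xs! ys! λ (v∈xs , v∈ys) → disjoint v∈xs v∈ys
    everywhere : ∀ v → v ∈ xs ++ ys
    everywhere v with any? (v ≟_) ys
    ... | yes v∈ys = ∈-++⁺ʳ xs v∈ys
    ... | no v∉ys  = ∈-++⁺ˡ (cover v∉ys)
    everything : xs ++ ys ∼[ set ] allFin n
    everything {v} = mk⇔ (λ _ → ∈-allFin v) (λ _ → everywhere v)

module _ {A : Set} {R : A → A → Set} where

  Consec-tail : ∀ {x xs} → Consec R (x ∷ xs) → Consec R xs
  Consec-tail {xs = []}    _       = tt
  Consec-tail {xs = _ ∷ _} (_ , c) = c

  Consec-++⁻ˡ : ∀ xs {ys} → Consec R (xs ++ ys) → Consec R xs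
  Consec-++⁻ˡ []           _       = tt
  Consec-++⁻ˡ (x ∷ [])     _       = tt
  Consec-++⁻ˡ (x ∷ y ∷ xs) (r , c) = r , Consec-++⁻ˡ (y ∷ xs) c

  Consec-split : ∀ xs {y} ys → Consec R (xs ++ y ∷ ys) → Consec R (xs ++ [ y ]) × Consec R (y ∷ ys)
  Consec-split []            ys c       = tt , c
  Consec-split (x ∷ [])      ys (r , c) = (r , tt) , c
  Consec-split (x ∷ x′ ∷ xs) ys (r , c) with c₁ , c₂ ← Consec-split (x′ ∷ xs) ys c = (r , c₁) , c₂

  Consec-join : ∀ xs {y} ys → Consec R (xs ++ [ y ]) → Consec R (y ∷ ys) → Consec R (xs ++ y ∷ ys)
  Consec-join []            ys _        c = c
  Consec-join (x ∷ [])      ys (r , _)  c = r , c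
  Consec-join (x ∷ x′ ∷ xs) ys (r , c₁) c = r , Consec-join (x′ ∷ xs) ys c₁ c

  Consec-rotate : ∀ x xs y ys
    → Consec R ((x ∷ xs ++ y ∷ ys) ++ [ x ]) → Consec R ((y ∷ ys ++ x ∷ xs) ++ [ y ])
  Consec-rotate x xs y ys closed
    with c₁ , c₂ ← Consec-split (x ∷ xs) (ys ++ [ x ])
                     (subst (Consec R) (cong (x ∷_) (++-assoc xs (y ∷ ys) [ x ])) closed)
    = subst (Consec R) (cong (y ∷_) (sym (++-assoc ys (x ∷ xs) [ y ])))
        (Consec-join (y ∷ ys) (xs ++ [ y ]) c₂ c₁)

data Paired {A : Set} (R : A → A → Set) : List A → Set where
  []  : Paired R []
  _∷_ : ∀ {x y xs} → R x y → Paired R xs → Paired R (x ∷ y ∷ xs)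

Consec⇒Paired⊎Odd : ∀ {A : Set} {R : A → A → Set} xs → Consec R xs → Paired R xs ⊎ Odd (length xs)
Consec⇒Paired⊎Odd []           _       = inj₁ []
Consec⇒Paired⊎Odd (x ∷ [])     _       = inj₂ (0 , refl)
Consec⇒Paired⊎Odd (x ∷ y ∷ xs) (r , c) with Consec⇒Paired⊎Odd xs (Consec-tail c)
... | inj₁ p        = inj₁ (r ∷ p)
... | inj₂ (k , eq) = inj₂ (suc k , trans (cong (2 +_) eq) (cong suc (sym (*-suc 2 k))))

Paired-mapWith∈ : ∀ {A : Set} {R S : A → A → Set} {xs}
  → (∀ {x y} → x ∈ xs → y ∈ xs → R x y → S x y) → Paired R xs → Paired S xs
Paired-mapWith∈ f []      = []
Paired-mapWith∈ f (r ∷ p) =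
  f (here refl) (there (here refl)) r ∷ Paired-mapWith∈ (λ x∈ y∈ → f (there (there x∈)) (there (there y∈))) p

module _ {n : ℕ} where

  Partners : List (Fin n) → Fin n → Fin n → Set
  Partners (x ∷ y ∷ xs) i j = (i ≡ x × j ≡ y) ⊎ (j ≡ x × i ≡ y) ⊎ Partners xs i j
  Partners _            _ _ = ⊥

  partners? : ∀ xs i j → Dec (Partners xs i j)
  partners? (x ∷ y ∷ xs) i j = (i ≟ x ×-dec j ≟ y) ⊎-dec (j ≟ x ×-dec i ≟ y) ⊎-dec partners? xs i j
  partners? []           _ _ = no λ ()
  partners? (_ ∷ [])     _ _ = no λ ()

  Partners-sym : ∀ xs {i j} → Partners xs i j → Partners xs j i
  Partners-sym (x ∷ y ∷ xs) (inj₁ p)        = inj₂ (inj₁ p)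
  Partners-sym (x ∷ y ∷ xs) (inj₂ (inj₁ p)) = inj₁ p
  Partners-sym (x ∷ y ∷ xs) (inj₂ (inj₂ p)) = inj₂ (inj₂ (Partners-sym xs p))

  Partners⇒∈ : ∀ xs {i j} → Partners xs i j → i ∈ xs
  Partners⇒∈ (x ∷ y ∷ xs) (inj₁ (refl , _))        = here refl
  Partners⇒∈ (x ∷ y ∷ xs) (inj₂ (inj₁ (_ , refl))) = there (here refl)
  Partners⇒∈ (x ∷ y ∷ xs) (inj₂ (inj₂ p))          = there (there (Partners⇒∈ xs p))

  Paired⇒Partners⊆R : ∀ {R : Fin n → Fin n → Set} {xs i j} → Symmetric R → Paired R xs
    → Partners xs i j → R i j
  Paired⇒Partners⊆R sym (r ∷ _) (inj₁ (refl , refl))        = r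
  Paired⇒Partners⊆R sym (r ∷ _) (inj₂ (inj₁ (refl , refl))) = sym r
  Paired⇒Partners⊆R sym (_ ∷ p) (inj₂ (inj₂ q))             = Paired⇒Partners⊆R sym p q

  Paired⇒unique-partner : ∀ {R : Fin n → Fin n → Set} {xs v} → Unique xs → Paired R xs → v ∈ xs
    → ∃ λ w → ∀ j → Partners xs v j ⇔ j ≡ w
  Paired⇒unique-partner {xs = x ∷ y ∷ xs} x∷y∷xs!@(_ ∷ y∷xs!) (_ ∷ _) (here refl) =
    y , λ j → mk⇔ to (λ j≡y → inj₁ (refl , j≡y))
    where
      to : ∀ {j} → Partners (x ∷ y ∷ xs) x j → j ≡ y
      to (inj₁ (_ , j≡y))        = j≡y
      to (inj₂ (inj₁ (_ , x≡y))) = ⊥-elim (Unique[x∷xs]⇒x∉xs x∷y∷xs! (here x≡y))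
      to (inj₂ (inj₂ p))         = ⊥-elim (Unique[x∷xs]⇒x∉xs x∷y∷xs! (there (Partners⇒∈ xs p)))
  Paired⇒unique-partner {xs = x ∷ y ∷ xs} x∷y∷xs!@(_ ∷ y∷xs!) (_ ∷ _) (there (here refl)) =
    x , λ j → mk⇔ to (λ j≡x → inj₂ (inj₁ (j≡x , refl)))
    where
      to : ∀ {j} → Partners (x ∷ y ∷ xs) y j → j ≡ x
      to (inj₁ (y≡x , _))        = ⊥-elim (Unique[x∷xs]⇒x∉xs x∷y∷xs! (here (sym y≡x)))
      to (inj₂ (inj₁ (j≡x , _))) = j≡x
      to (inj₂ (inj₂ p))         = ⊥-elim (Unique[x∷xs]⇒x∉xs y∷xs! (Partners⇒∈ xs p))
  Paired⇒unique-partner {xs = x ∷ y ∷ xs} {v} x∷y∷xs!@(_ ∷ y∷xs!@(_ ∷ xs!)) (_ ∷ p) (there (there v∈xs))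
    with w , partner ← Paired⇒unique-partner xs! p v∈xs =
    w , λ j → mk⇔ to (λ j≡w → inj₂ (inj₂ (Equivalence.from (partner j) j≡w)))
    where
      to : ∀ {j} → Partners (x ∷ y ∷ xs) v j → j ≡ w
      to (inj₁ (refl , _))        = ⊥-elim (Unique[x∷xs]⇒x∉xs x∷y∷xs! (there v∈xs))
      to (inj₂ (inj₁ (_ , refl))) = ⊥-elim (Unique[x∷xs]⇒x∉xs y∷xs! v∈xs)
      to {j} (inj₂ (inj₂ q))      = Equivalence.to (partner j) q

indicator : Bool → ℚ
indicator b = if b then 1ℚ else 0ℚ

sumℚ-cong : ∀ {n} {f g : Fin n → ℚ} → (∀ j → f j ≡ g j) → sumℚ f ≡ sumℚ g
sumℚ-cong {zero}  f≗g = refl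
sumℚ-cong {suc n} f≗g = cong₂ ℚ._+_ (f≗g zero) (sumℚ-cong (λ j → f≗g (suc j)))

sumℚ-zero : ∀ n → sumℚ {n} (λ _ → 0ℚ) ≡ 0ℚ
sumℚ-zero zero    = refl
sumℚ-zero (suc n) = cong (0ℚ ℚ.+_) (sumℚ-zero n)

sumℚ-indicator : ∀ {n} (w : Fin n) → sumℚ (λ j → indicator (does (j ≟ w))) ≡ 1ℚ
sumℚ-indicator {suc n} zero    = cong (1ℚ ℚ.+_) (sumℚ-zero n)
sumℚ-indicator {suc n} (suc w) = cong (0ℚ ℚ.+_) (sumℚ-indicator w)

module _ {n : ℕ} {G : Graph n} where

  EdgeOf-sym : ∀ {F : FaultSet G} → Symmetric (EdgeOf F)
  EdgeOf-sym {x = i} {j} (ij∈G , i∉F , j∉F , ij∉F , ji∉F) =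
    trans (Graph.sym G j i) ij∈G , j∉F , i∉F , ji∉F , ij∉F

  Paired⇒FractionalPerfectMatching : ∀ {F : FaultSet G} {xs} → Unique xs
    → (∀ v → VertexOf F v → v ∈ xs) → Paired (EdgeOf F) xs → FractionalPerfectMatching F
  Paired⇒FractionalPerfectMatching {F} {xs} xs! covers paired = g , g-sym , g-bounds , g-support , g-rows
    where
      g : Fin n → Fin n → ℚ
      g i j = indicator (does (partners? xs i j))
      g-sym : ∀ i j → g i j ≡ g j i
      g-sym i j = cong indicator
        (does-⇔ (mk⇔ (Partners-sym xs) (Partners-sym xs)) (partners? xs i j) (partners? xs j i))
      g-bounds : ∀ i j → (0ℚ ℚ.≤ g i j) × (g i j ℚ.≤ 1ℚ)
      g-bounds i j with does (partners? xs i j)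
      ... | true  = nonNegative⁻¹ 1ℚ , ≤-refl
      ... | false = ≤-refl , nonNegative⁻¹ 1ℚ
      g-support : ∀ i j → ¬ EdgeOf F i j → g i j ≡ 0ℚ
      g-support i j ¬ij with partners? xs i j
      ... | yes ij = ⊥-elim (¬ij (Paired⇒Partners⊆R (EdgeOf-sym {F}) paired ij))
      ... | no _   = refl
      g-rows : ∀ v → VertexOf F v → sumℚ (g v) ≡ 1ℚ
      g-rows v v∉F with w , partner ← Paired⇒unique-partner xs! paired (covers v v∉F) =
        trans (sumℚ-cong (λ j → cong indicator (does-⇔ (partner j) (partners? xs v j) (j ≟ w))))
              (sumℚ-indicator w)

  Spans : FaultSet G → List (Fin n) → Set
  Spans F xs = ∀ v → (v ∈ xs → VertexOf F v) × (VertexOf F v → v ∈ xs)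

  Spans-resp-↭ : ∀ {F : FaultSet G} {xs ys} → xs ↭ ys → Spans F xs → Spans F ys
  Spans-resp-↭ xs↭ys spans v =
    (λ v∈ys → proj₁ (spans v) (∈-resp-↭ (↭-sym xs↭ys) v∈ys)) , (λ v∉F → ∈-resp-↭ xs↭ys (proj₂ (spans v) v∉F))

  Spans⇒length : ∀ {F : FaultSet G} {xs} → Unique xs → Spans F xs → length xs ≡ n ∸ length (vs F)
  Spans⇒length {F} {xs} xs! spans = begin
    length xs                                 ≡⟨ sym (m+n∸n≡m (length xs) (length (vs F))) ⟩
    length xs + length (vs F) ∸ length (vs F) ≡⟨ cong (_∸ length (vs F)) xs+F≡n ⟩
    n ∸ length (vs F)                         ∎
    where
      open ≡-Reasoning
      xs+F≡n = length-complement xs! (vs-uniq F) (λ {v} → proj₁ (spans v)) (λ {v} → proj₂ (spans v))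

  HamCycle-rotate : ∀ {F : FaultSet G} {c v} → HamCycle F c → VertexOf F v → ∃ λ ys → HamCycle F (v ∷ ys)
  HamCycle-rotate {c = []} ()
  HamCycle-rotate {F} {x ∷ xs} {v} cycle@(x∷xs! , 3≤∣c∣ , spans , closed) v∉F with proj₂ (spans v) v∉F
  ... | here refl = xs , cycle
  ... | there v∈xs with ys , zs , refl ← ∈-∃++ v∈xs =
    zs ++ x ∷ ys , Unique-resp-↭ π x∷xs! , subst (3 ≤_) (↭-length π) 3≤∣c∣ , Spans-resp-↭ {F} π spans ,
    Consec-rotate x ys v zs closed
    where
      π : x ∷ ys ++ v ∷ zs ↭ v ∷ zs ++ x ∷ ys
      π = ++-comm (x ∷ ys) (v ∷ zs)

  hamiltonianPath-odd : ∀ {F : FaultSet G} {R xs} → Unique xs → Spans F xs → Consec R xs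
    → (Paired R xs → Paired (EdgeOf F) xs) → ¬ FractionalPerfectMatching F → Odd (n ∸ length (vs F))
  hamiltonianPath-odd {F} {xs = xs} xs! spans path transfer noFPM with Consec⇒Paired⊎Odd xs path
  ... | inj₁ paired =
    ⊥-elim (noFPM (Paired⇒FractionalPerfectMatching {F} xs! (λ v → proj₂ (spans v)) (transfer paired)))
  ... | inj₂ odd    = subst Odd (Spans⇒length {F} xs! spans) odd

  withVertex : (F : FaultSet G) (v : Fin n) → All (v ≢_) (vs F) → FaultSet G
  withVertex F v v∉F = record F { vs = v ∷ vs F ; vs-uniq = v∉F ∷ vs-uniq F }

  withEdge : (F : FaultSet G) {i j : Fin n} → All ((i , j) ≢_) (es F)
    → (adj G i j ≡ true) × (toℕ i < toℕ j) → FaultSet G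
  withEdge F {i} {j} e∉F e∈G =
    record F { es = (i , j) ∷ es F ; es-uniq = e∉F ∷ es-uniq F ; es-edge = e∈G ∷ es-edge F }

  Spans-withVertex : ∀ {F : FaultSet G} {v ys} (v∉F : All (v ≢_) (vs F)) → Unique (v ∷ ys) → Spans F (v ∷ ys)
    → Spans (withVertex F v v∉F) ys
  Spans-withVertex {F} {v} {ys} v∉F v∷ys! spans w = vertex , covered
    where
      vertex : w ∈ ys → VertexOf (withVertex F v v∉F) w
      vertex w∈ys (here refl)  = Unique[x∷xs]⇒x∉xs v∷ys! w∈ys
      vertex w∈ys (there w∈F) = proj₁ (spans w) (there w∈ys) w∈F
      covered : VertexOf (withVertex F v v∉F) w → w ∈ ys
      covered w∉F′ with proj₂ (spans w) (λ w∈F → w∉F′ (there w∈F))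
      ... | here refl   = ⊥-elim (w∉F′ (here refl))
      ... | there w∈ys = w∈ys

  withVertex-odd : (F : FaultSet G) (v : Fin n) (v∉F : All (v ≢_) (vs F)) → Hamiltonian-minus F
    → ¬ FractionalPerfectMatching (withVertex F v v∉F) → Odd (n ∸ length (vs (withVertex F v v∉F)))
  withVertex-odd F v v∉F (_ , cycle) noFPM
    with ys , (v∷ys!@(_ ∷ ys!) , _ , spans , closed) ← HamCycle-rotate cycle (All¬⇒¬Any v∉F) =
    hamiltonianPath-odd {withVertex F v v∉F} ys! spans′ (Consec-++⁻ˡ ys (Consec-tail closed))
      (Paired-mapWith∈ restrict) noFPM
    where
      spans′ : Spans (withVertex F v v∉F) ys
      spans′ = Spans-withVertex {F} v∉F v∷ys! spans
      restrict : ∀ {a b} → a ∈ ys → b ∈ ys → EdgeOf F a b → EdgeOf (withVertex F v v∉F) a b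
      restrict a∈ys b∈ys (ab∈G , _ , _ , ab∉F , ba∉F) =
        ab∈G , proj₁ (spans′ _) a∈ys , proj₁ (spans′ _) b∈ys , ab∉F , ba∉F

  Paired-withEdge : ∀ {F : FaultSet G} {i j} {e∉F : All ((i , j) ≢_) (es F)} {e∈G} {u w rest}
    → (u ≡ i × w ≢ j) ⊎ (u ≡ j × w ≢ i) → Unique (u ∷ w ∷ rest)
    → Paired (EdgeOf F) (u ∷ w ∷ rest) → Paired (EdgeOf (withEdge F e∉F e∈G)) (u ∷ w ∷ rest)
  Paired-withEdge {F} {i} {j} {e∉F} {e∈G} {u} {w} {rest} endpoint u∷w∷rest!@(_ ∷ w∷rest!) (uw ∷ p) =
    avoiding uw (first≢e endpoint) (first≢e′ endpoint)
      ∷ Paired-mapWith∈ (λ a∈ b∈ ab → avoiding ab (rest≢e endpoint a∈ b∈) (rest≢e endpoint b∈ a∈)) p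
    where
      avoiding : ∀ {a b} → EdgeOf F a b → (a , b) ≢ (i , j) → (b , a) ≢ (i , j)
        → EdgeOf (withEdge F e∉F e∈G) a b
      avoiding (ab∈G , a∉F , b∉F , ab∉F , ba∉F) ab≢e ba≢e =
        ab∈G , a∉F , b∉F , (λ { (here ab≡e) → ab≢e ab≡e ; (there ab∈F) → ab∉F ab∈F })
                         , (λ { (here ba≡e) → ba≢e ba≡e ; (there ba∈F) → ba∉F ba∈F })
      u≢w : u ≢ w
      u≢w u≡w = Unique[x∷xs]⇒x∉xs u∷w∷rest! (here u≡w)
      u∉rest : u ∉ rest
      u∉rest u∈rest = Unique[x∷xs]⇒x∉xs u∷w∷rest! (there u∈rest)
      Endpoint : Set
      Endpoint = (u ≡ i × w ≢ j) ⊎ (u ≡ j × w ≢ i)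
      first≢e : Endpoint → (u , w) ≢ (i , j)
      first≢e (inj₁ (_ , w≢j))  uw≡e = w≢j (cong proj₂ uw≡e)
      first≢e (inj₂ (u≡j , _)) uw≡e = u≢w (trans u≡j (sym (cong proj₂ uw≡e)))
      first≢e′ : Endpoint → (w , u) ≢ (i , j)
      first≢e′ (inj₁ (u≡i , _))  wu≡e = u≢w (trans u≡i (sym (cong proj₁ wu≡e)))
      first≢e′ (inj₂ (_ , w≢i)) wu≡e = w≢i (cong proj₁ wu≡e)
      rest≢e : Endpoint → ∀ {a b} → a ∈ rest → b ∈ rest → (a , b) ≢ (i , j)
      rest≢e (inj₁ (u≡i , _)) a∈ _ ab≡e = u∉rest (subst (_∈ rest) (trans (cong proj₁ ab≡e) (sym u≡i)) a∈)
      rest≢e (inj₂ (u≡j , _)) _ b∈ ab≡e = u∉rest (subst (_∈ rest) (trans (cong proj₂ ab≡e) (sym u≡j)) b∈)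

  withEdge-odd : (F : FaultSet G) {i j : Fin n} (e∉F : All ((i , j) ≢_) (es F))
    (e∈G : (adj G i j ≡ true) × (toℕ i < toℕ j)) → VertexOf F i → Hamiltonian-minus F
    → ¬ FractionalPerfectMatching (withEdge F e∉F e∈G) → Odd (n ∸ length (vs F))
  withEdge-odd F {i} {j} e∉F e∈G i∉F (_ , cycle) noFPM with HamCycle-rotate cycle i∉F
  ... | [] , (_ , s≤s () , _)
  ... | _ ∷ [] , (_ , s≤s (s≤s ()) , _)
  ... | h ∷ r ∷ rs , (cycle! , _ , spans , closed) with h ≟ j
  ...   | no h≢j   =
    hamiltonianPath-odd {withEdge F e∉F e∈G} cycle! spans (Consec-++⁻ˡ (i ∷ h ∷ r ∷ rs) closed)
      (Paired-withEdge {F} {e∉F = e∉F} {e∈G} (inj₁ (refl , h≢j)) cycle!) noFPM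
  ...   | yes refl =
    hamiltonianPath-odd {withEdge F e∉F e∈G} path! (Spans-resp-↭ {F} π spans) (Consec-tail closed)
      (Paired-withEdge {F} {e∉F = e∉F} {e∈G} (inj₂ (refl , r≢i)) path!) noFPM
    where
      π : i ∷ h ∷ r ∷ rs ↭ h ∷ r ∷ rs ++ [ i ]
      π = ++-comm [ i ] (h ∷ r ∷ rs)
      path! : Unique (h ∷ r ∷ rs ++ [ i ])
      path! = Unique-resp-↭ π cycle!
      r≢i : r ≢ i
      r≢i r≡i = Unique[x∷xs]⇒x∉xs cycle! (there (here (sym r≡i)))

  noFPM⇒odd : ∀ {f} → FaultHamiltonian f G → (F : FaultSet G) → size F ≡ suc f
    → ¬ FractionalPerfectMatching F → Odd (n ∸ length (vs F))
  noFPM⇒odd FH record { vs = [] ; es = [] } ()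
  noFPM⇒odd FH record { vs = v ∷ vs ; es = es ; vs-uniq = v∉vs ∷ vs! ; es-uniq = es! ; es-edge = es⊆G }
    size≡1+f =
    withVertex-odd F v v∉vs (FH F (≤-reflexive (suc-injective size≡1+f)))
    where
      F : FaultSet G
      F = record { vs = vs ; es = es ; vs-uniq = vs! ; es-uniq = es! ; es-edge = es⊆G }
  noFPM⇒odd FH record { vs = [] ; es = e ∷ es ; vs-uniq = [] ; es-uniq = e∉es ∷ es! ; es-edge = e∈G ∷ es⊆G }
    size≡1+f =
    withEdge-odd F e∉es e∈G (λ ()) (FH F (≤-reflexive (suc-injective size≡1+f)))
    where
      F : FaultSet G
      F = record { vs = [] ; es = es ; vs-uniq = [] ; es-uniq = es! ; es-edge = es⊆G }

  faultEdges≤ : ∀ {f} (F : FaultSet G) → size F ≡ suc f → Odd (n ∸ length (vs F)) → Even n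
    → length (es F) ≤ f
  faultEdges≤ record { vs = [] }     _         odd even = ⊥-elim (Odd⇒¬Even odd even)
  faultEdges≤ record { vs = _ ∷ vs ; es = es } size≡1+f _ _ =
    subst (length es ≤_) (suc-injective size≡1+f) (m≤n+m (length es) (length vs))

lemma3p4 : ∀ {n} (G : Graph n) (δ : ℕ) → MinDegree G δ → 3 ≤ δ
    → FaultHamiltonian (δ ∸ 2) G
    → (F : FaultSet G) → size F ≡ δ ∸ 1
    → ¬ FractionalPerfectMatching F
    → Odd (n ∸ length (vs F)) × (Even n → length (es F) ≤ δ ∸ 2)
lemma3p4 {n} G δ _ (s≤s (s≤s _)) FH F size≡δ-1 noFPM = odd , faultEdges≤ F size≡δ-1 odd
  where
    odd : Odd (n ∸ length (vs F))
    odd = noFPM⇒odd FH F size≡δ-1 noFPM
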